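{- Let $r$, $l$, $m$ be positive integers with $l\ge 2$ and $m\ge 3$, let $G=P_l[K_{1,m}]$, and let $\delta$ and $\Delta$ denote the minimum and maximum degree of $G$. Then: (i) $\chi_r(G)=4$ for $1\le r\le 3$; (ii) for $4\le r\le \delta-1$, $\chi_r(G)=r+i$ for some integer $i\ge 2$; (iii) if $l=2$, then $\chi_r(G)=2m$ for $\delta\le r\le \Delta$; (iv) if $l\neq 2$, then $\chi_r(G)=2m$ for $r=\delta$; (v) if $l\neq 2$, then for $\delta+1\le r\le \Delta-m+1$, $\chi_r(G)=2m+i$ for some positive integer $i$; (vi) if $l\ge 3$, then $\chi_r(G)=3m$ for $\Delta-m+2\le r\le \Delta$.
   Context: All graphs are finite, simple, undirected. An $r$-dynamic $k$-coloring of a graph $G$ is a map $c:V(G)\to\{1,\dots,k\}$ such that $c(u)\neq c(v)$ for every edge $uv$, and for every vertex $v$, $|c(N(v))|\ge \min\{r,d(v)\}$, where $N(v)$ is the set of neighbours of $v$ and $d(v)$ its degree. The $r$-dynamic chromatic number $\chi_r(G)$ is the least $k$ for which an $r$-dynamic $k$-coloring exists. $P_l$ is the path on $l$ vertices. In this statement $K_{1,m}$ denotes the star with $m$ vertices in total: a center $s_0$ adjacent to the $m-1$ pendant vertices $s_1,\dots,s_{m-1}$. The lexicographic product $G_1[G_2]$ has vertex set $V(G_1)\times V(G_2)$, with $(g,h)$ adjacent to $(g',h')$ iff $gg'\in E(G_1)$, or $g=g'$ and $hh'\in E(G_2)$. -}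

module Defs where

open import Data.Bool using (Bool; true; false; _∧_; _∨_; not; T)
open import Data.Nat using (ℕ; zero; suc; _+_; _*_; _≤_; _<_; _⊓_; _≡ᵇ_)
open import Data.Fin using (Fin; toℕ; remQuot)
open import Data.Fin.Properties using (_≟_)
open import Data.List using (List; length; filterᵇ; allFin)
open import Data.Bool.ListAction using (any)
open import Data.Product using (Σ; _×_; _,_; ∃)
open import Relation.Nullary using (¬_)
open import Relation.Nullary.Decidable using (isYes)
open import Relation.Binary.PropositionalEquality using (_≡_; _≢_)

-- A finite graph on vertex set Fin n, with Boolean adjacency.
-- (All graphs built below are symmetric and loopless by construction.)
record Graph : Set where
  constructor mkGraph
  field
    n     : ℕ
    adj   : Fin n → Fin n → Bool
open Graph public

N : (G : Graph) → Fin (n G) → List (Fin (n G))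
N G v = filterᵇ (adj G v) (allFin (n G))

deg : (G : Graph) → Fin (n G) → ℕ
deg G v = length (N G v)

IsMinDeg : Graph → ℕ → Set
IsMinDeg G d = (∀ v → d ≤ deg G v) × ∃ λ v → deg G v ≡ d

IsMaxDeg : Graph → ℕ → Set
IsMaxDeg G d = (∀ v → deg G v ≤ d) × ∃ λ v → deg G v ≡ d

nbrColours : (G : Graph) {k : ℕ} → (Fin (n G) → Fin k) → Fin (n G) → ℕ
nbrColours G {k} c v =
  length (filterᵇ (λ j → any (λ u → isYes (c u ≟ j)) (N G v)) (allFin k))

IsDynColouring : ℕ → (G : Graph) (k : ℕ) → (Fin (n G) → Fin k) → Set
IsDynColouring r G k c =
  (∀ u v → T (adj G u v) → c u ≢ c v) ×
  (∀ v → (r ⊓ deg G v) ≤ nbrColours G c v)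

HasDynColouring : ℕ → Graph → ℕ → Set
HasDynColouring r G k = Σ (Fin (n G) → Fin k) (IsDynColouring r G k)

IsDynChromNum : ℕ → Graph → ℕ → Set
IsDynChromNum r G k = HasDynColouring r G k × (∀ j → j < k → ¬ HasDynColouring r G j)

pathAdj : (l : ℕ) → Fin l → Fin l → Bool
pathAdj l i j = (suc (toℕ i) ≡ᵇ toℕ j) ∨ (suc (toℕ j) ≡ᵇ toℕ i)

-- Star K_{1,m} with m vertices in total: centre 0, leaves 1..m-1
isCentre : {m : ℕ} → Fin m → Bool
isCentre i = toℕ i ≡ᵇ 0

starAdj : (m : ℕ) → Fin m → Fin m → Bool
starAdj m i j = (isCentre i ∧ not (isCentre j)) ∨ (isCentre j ∧ not (isCentre i))

Path : ℕ → Graph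
Path l = mkGraph l (pathAdj l)

Star : ℕ → Graph
Star m = mkGraph m (starAdj m)

lexAdj : (G₁ G₂ : Graph) → Fin (n G₁ * n G₂) → Fin (n G₁ * n G₂) → Bool
lexAdj G₁ G₂ x y with remQuot (n G₂) x | remQuot (n G₂) y
... | (g , h) | (g′ , h′) = adj G₁ g g′ ∨ (isYes (g ≟ g′) ∧ adj G₂ h h′)

Lex : Graph → Graph → Graph
Lex G₁ G₂ = mkGraph (n G₁ * n G₂) (lexAdj G₁ G₂)

{-# OPTIONS --safe #-}
-- Write M for the number of vertices of the star, so that (g,h) has degree deg g · M + deg h:
-- δ = M + 1 is attained at a leaf of an end copy, and for l ≥ 3 the centre of an inner copy
-- has degree 3M − 1. All lower bounds come from a leaf h of two consecutive copies 0 and 1: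
-- apart from one colour each, (0,h) sees only colours of copy 1 and (1,h) only colours of the
-- copies adjacent to copy 1, and a proper colouring keeps these apart, so any r-dynamic
-- colouring uses at least (min(r, deg(0,h)) − 1) + (min(r, deg(1,h)) − 1) colours; besides,
-- two copies of an edge of the star span a K₄. The matching colourings are products
-- (g,h) ↦ (φ g, ψ h), with φ the parity or the residue mod 3 along the path and ψ the centre
-- indicator or the identity on the star. Where the value is only bounded, χ_r exists because
-- the identity colouring is r-dynamic and r-dynamic colourability with k colours is decidable.
module Submission where

open import Defs
open import Data.Nat using (ℕ; _+_; _*_; _∸_; _≤_; _<_)
open import Data.Product using (_×_; ∃)
open import Relation.Binary.PropositionalEquality using (_≡_; _≢_)

open import Data.Nat.Properties using (+-*-semiring)
open import Algebra.Properties.Semiring.Sum +-*-semiring using (sum; sum-cong-≗; ∑-distrib-+; *-distribʳ-sum)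
open import Data.Bool using (Bool; true; false; _∧_; _∨_; not; T; if_then_else_)
open import Data.Bool.ListAction using (any)
open import Data.Bool.Properties using (T-∧; T-∨)
open import Data.Empty using (⊥; ⊥-elim)
open import Data.Fin using (Fin; zero; suc; toℕ; inject₁; combine; remQuot; _↑ˡ_; _↑ʳ_)
open import Data.Fin.Patterns using (0F; 1F; 2F)
open import Data.Fin.Properties
  using (_≟_; 0≢1+n; injective⇒≤; toℕ-inject₁; toℕ-injective; remQuot-combine; combine-remQuot;
         combine-injective; combine-injectiveˡ; combine-injectiveʳ)
import Data.Fin.Properties as Fin
open import Data.List using (length; filterᵇ; tabulate; allFin)
open import Data.List.Membership.Propositional using (find; lose)
open import Data.List.Membership.Propositional.Properties using (∈-filter⁺; ∈-filter⁻; ∈-allFin)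
open import Data.List.Relation.Unary.Any.Properties using (any⁺; any⁻)
open import Data.Nat using (zero; suc; _⊓_; _≤?_; _≡ᵇ_; z≤n; s≤s; s≤s⁻¹)
open import Data.Nat.Properties
  using (module ≤-Reasoning; ≡ᵇ⇒≡; ≡⇒≡ᵇ; 1+n≢n; suc-injective; anyUpTo?;
         +-assoc; +-comm; +-suc; +-identityʳ; *-identityˡ; +-mono-≤; +-monoˡ-≤; +-monoʳ-≤; *-monoˡ-≤;
         ∸-monoˡ-≤; m+n∸m≡n; m+[n∸m]≡n; ⊓-glb; m⊓n≤m; m⊓n≤n;
         ≤-refl; ≤-reflexive; ≤-trans; ≤-antisym; <-≤-trans; <⇒≱; n≤1+n; n<1+n; m≤m+n; m≤n⇒m≤1+n)
open import Data.Nat.Tactic.RingSolver using (solve-∀)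
open import Data.Product using (Σ; _,_; proj₁; proj₂)
open import Data.Sum using (_⊎_; inj₁; inj₂)
open import Data.Vec.Functional using (_∷_)
open import Function using (_∘_; id; Equivalence)
open import Relation.Nullary using (¬_; Dec; yes; no; ¬?)
open import Relation.Nullary.Decidable
  using (isYes; map′; ⌊⌋-map′; toWitness; fromWitness; fromWitnessFalse; T?; _→-dec_; _×-dec_)
open import Relation.Binary.PropositionalEquality using (refl; sym; trans; cong; cong₂; subst; module ≡-Reasoning)

-- Counting Boolean predicates on Fin k

indicator : Bool → ℕ
indicator b = if b then 1 else 0

count : ∀ {k} → (Fin k → Bool) → ℕ
count p = sum (indicator ∘ p)

sum-mono-≤ : ∀ {k} {f g : Fin k → ℕ} → (∀ i → f i ≤ g i) → sum f ≤ sum g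
sum-mono-≤ {zero}  _   = z≤n
sum-mono-≤ {suc k} f≤g = +-mono-≤ (f≤g zero) (sum-mono-≤ (f≤g ∘ suc))

count-cong : ∀ {k} {p q : Fin k → Bool} → (∀ j → p j ≡ q j) → count p ≡ count q
count-cong p≗q = sum-cong-≗ (cong indicator ∘ p≗q)

indicator-mono : ∀ {a b} → (T a → T b) → indicator a ≤ indicator b
indicator-mono {false}          _   = z≤n
indicator-mono {true}  {true}   _   = ≤-refl
indicator-mono {true}  {false} a⇒b = ⊥-elim (a⇒b _)

count-mono : ∀ {k} {p q : Fin k → Bool} → (∀ j → T (p j) → T (q j)) → count p ≤ count q
count-mono p⊆q = sum-mono-≤ (indicator-mono ∘ p⊆q)

count-true : ∀ k → count {k} (λ _ → true) ≡ k
count-true zero    = refl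
count-true (suc k) = cong suc (count-true k)

count-false : ∀ k → count {k} (λ _ → false) ≡ 0
count-false zero    = refl
count-false (suc k) = count-false k

count-≤ : ∀ {k} (p : Fin k → Bool) → count p ≤ k
count-≤ {k} p = ≤-trans (count-mono {p = p} {q = λ _ → true} (λ _ _ → _)) (≤-reflexive (count-true k))

indicator-∨ : ∀ a b → indicator (a ∨ b) ≤ indicator a + indicator b
indicator-∨ true  _ = s≤s z≤n
indicator-∨ false _ = ≤-refl

count-∨ : ∀ {k} (p q : Fin k → Bool) → count (λ j → p j ∨ q j) ≤ count p + count q
count-∨ p q = ≤-trans (sum-mono-≤ (λ j → indicator-∨ (p j) (q j)))
                      (≤-reflexive (∑-distrib-+ (indicator ∘ p) (indicator ∘ q)))

indicator-∨-disjoint : ∀ {a b} → (T a → T b → ⊥) → indicator (a ∨ b) ≡ indicator a + indicator b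
indicator-∨-disjoint {true}  {true}  a∩b = ⊥-elim (a∩b _ _)
indicator-∨-disjoint {true}  {false} _   = refl
indicator-∨-disjoint {false}         _   = refl

count-∨-disjoint : ∀ {k} {p q : Fin k → Bool} → (∀ j → T (p j) → T (q j) → ⊥) →
                   count (λ j → p j ∨ q j) ≡ count p + count q
count-∨-disjoint {p = p} {q} p∩q =
  trans (sum-cong-≗ (indicator-∨-disjoint ∘ p∩q)) (∑-distrib-+ (indicator ∘ p) (indicator ∘ q))

count-singleton : ∀ {k} (i : Fin k) → count (λ j → isYes (i ≟ j)) ≡ 1
count-singleton {suc k} zero    = cong suc (count-false k)
count-singleton {suc k} (suc i) =
  trans (count-cong {p = λ j → isYes (suc i ≟ suc j)} (λ j → ⌊⌋-map′ _ _ (i ≟ j))) (count-singleton i)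

count-split : ∀ a {b} (p : Fin (a + b) → Bool) →
              count p ≡ count (p ∘ (_↑ˡ b)) + count (p ∘ (a ↑ʳ_))
count-split zero    p = refl
count-split (suc a) p =
  trans (cong (indicator (p zero) +_) (count-split a (p ∘ suc)))
        (sym (+-assoc (indicator (p zero)) _ _))

count-combine : ∀ a {b} (p : Fin (a * b) → Bool) →
                count p ≡ sum (λ (g : Fin a) → count {b} (p ∘ combine g))
count-combine zero    p = refl
count-combine (suc a) {b} p =
  trans (count-split b p) (cong (count (p ∘ (_↑ˡ (a * b))) +_) (count-combine a (p ∘ (b ↑ʳ_))))

count-∨-∧ : ∀ {b} x y (q : Fin b → Bool) → (T x → T y → ⊥) →
            count (λ j → x ∨ (y ∧ q j)) ≡ indicator x * b + indicator y * count q
count-∨-∧ {b} true  true  q x∩y = ⊥-elim (x∩y _ _)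
count-∨-∧ {b} true  false q _   = trans (count-true b) (sym (trans (+-identityʳ _) (+-identityʳ b)))
count-∨-∧     false true  q _   = sym (+-identityʳ (count q))
count-∨-∧ {b} false false q _   = count-false b

T-not : ∀ {b} → T b → T (not b) → ⊥
T-not {true} _ ()

injectiveOn⇒count≤ : ∀ {a b} {p : Fin a → Bool} {q : Fin b → Bool} (f : Fin a → Fin b) →
                     (∀ i j → T (p i) → T (p j) → f i ≡ f j → i ≡ j) →
                     (∀ i → T (p i) → T (q (f i))) → count p ≤ count q
injectiveOn⇒count≤ {zero} f _ _ = z≤n
injectiveOn⇒count≤ {suc a} {p = p} {q} f f-inj p⇒q with p zero in p₀
... | false = injectiveOn⇒count≤ (f ∘ suc) (λ i j pi pj → Fin.suc-injective ∘ f-inj (suc i) (suc j) pi pj) (p⇒q ∘ suc)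
... | true  = ≤-trans (s≤s (injectiveOn⇒count≤ {q = q′} (f ∘ suc) tail-inj tail⇒q′)) q-split
  where
  T-p₀ : T (p zero)
  T-p₀ = subst T (sym p₀) _
  q′ : _ → Bool
  q′ j = q j ∧ not (isYes (f zero ≟ j))
  tail-inj : ∀ i j → T (p (suc i)) → T (p (suc j)) → f (suc i) ≡ f (suc j) → i ≡ j
  tail-inj i j pi pj = Fin.suc-injective ∘ f-inj (suc i) (suc j) pi pj
  tail⇒q′ : ∀ i → T (p (suc i)) → T (q′ (f (suc i)))
  tail⇒q′ i pi = Equivalence.from T-∧
    (p⇒q (suc i) pi , fromWitnessFalse (λ f₀≡ → 0≢1+n (f-inj zero (suc i) T-p₀ pi f₀≡)))
  singleton : Fin _ → Bool
  singleton j = isYes (f zero ≟ j)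
  q-split : suc (count q′) ≤ count q
  q-split = begin
    suc (count q′)                            ≡⟨ cong (_+ count q′) (count-singleton (f zero)) ⟨
    count singleton + count q′                ≡⟨ count-∨-disjoint {p = singleton} {q = q′} disjoint ⟨
    count (λ j → singleton j ∨ q′ j)          ≤⟨ count-mono {p = λ j → singleton j ∨ q′ j} {q = q} covered ⟩
    count q                                   ∎
    where
    open ≤-Reasoning
    disjoint : ∀ j → T (singleton j) → T (q′ j) → ⊥
    disjoint j s t = T-not s (proj₂ (Equivalence.to T-∧ t))
    covered : ∀ j → T (singleton j ∨ q′ j) → T (q j)
    covered j s∨t with Equivalence.to T-∨ s∨t
    ... | inj₁ s = subst (T ∘ q) (toWitness s) (p⇒q zero T-p₀)
    ... | inj₂ t = proj₁ (Equivalence.to T-∧ t)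

-- Degrees, neighbour colours and the dynamic chromatic number

length-filterᵇ-tabulate : ∀ {A : Set} {k} (p : A → Bool) (f : Fin k → A) →
                          length (filterᵇ p (tabulate f)) ≡ count (p ∘ f)
length-filterᵇ-tabulate {k = zero}  p f = refl
length-filterᵇ-tabulate {k = suc k} p f with p (f zero)
... | true  = cong suc (length-filterᵇ-tabulate p (f ∘ suc))
... | false = length-filterᵇ-tabulate p (f ∘ suc)

deg≡count : ∀ G v → deg G v ≡ count (adj G v)
deg≡count G v = length-filterᵇ-tabulate (adj G v) id

colourSeen : (G : Graph) {k : ℕ} → (Fin (n G) → Fin k) → Fin (n G) → Fin k → Bool
colourSeen G c v j = any (λ u → isYes (c u ≟ j)) (N G v)

nbrColours≡count : ∀ G {k} (c : Fin (n G) → Fin k) v → nbrColours G c v ≡ count (colourSeen G c v)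
nbrColours≡count G c v = length-filterᵇ-tabulate (colourSeen G c v) id

colourSeen⁺ : ∀ G {k} (c : Fin (n G) → Fin k) {v u} → T (adj G v u) → T (colourSeen G c v (c u))
colourSeen⁺ G c {v} {u} v~u = any⁺ _ (lose (∈-filter⁺ (T? ∘ adj G v) (∈-allFin u) v~u) (fromWitness refl))

colourSeen⁻ : ∀ G {k} (c : Fin (n G) → Fin k) {v j} → T (colourSeen G c v j) →
              ∃ λ u → T (adj G v u) × c u ≡ j
colourSeen⁻ G c {v} seen with find (any⁻ _ (N G v) seen)
... | u , u∈N , cu≡j = u , proj₂ (∈-filter⁻ (T? ∘ adj G v) {xs = allFin (n G)} u∈N) , toWitness cu≡j

IsProperColouring : (G : Graph) {k : ℕ} → (Fin (n G) → Fin k) → Set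
IsProperColouring G c = ∀ u v → T (adj G u v) → c u ≢ c v

Loopless : Graph → Set
Loopless G = ∀ v → ¬ T (adj G v v)

InjectiveOnClosedNbhds : (G : Graph) {k : ℕ} → (Fin (n G) → Fin k) → Set
InjectiveOnClosedNbhds G c =
  ∀ v u w → v ≡ u ⊎ T (adj G v u) → v ≡ w ⊎ T (adj G v w) → c u ≡ c w → u ≡ w

injectiveOnClosedNbhds⇒proper : ∀ G {k} {c : Fin (n G) → Fin k} →
                                Loopless G → InjectiveOnClosedNbhds G c → IsProperColouring G c
injectiveOnClosedNbhds⇒proper G loopless c-inj u v u~v same =
  loopless u (subst (T ∘ adj G u) (sym (c-inj u u v (inj₁ refl) (inj₂ u~v) same)) u~v)

nbrColours-≤ : ∀ G {k} (c : Fin (n G) → Fin k) v (q : Fin k → Bool) →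
               (∀ u → T (adj G v u) → T (q (c u))) → nbrColours G c v ≤ count q
nbrColours-≤ G c v q nbrs⇒q = ≤-trans (≤-reflexive (nbrColours≡count G c v))
  (count-mono {p = colourSeen G c v} λ j seen →
    let u , v~u , cu≡j = colourSeen⁻ G c seen in subst (T ∘ q) cu≡j (nbrs⇒q u v~u))

nbrColours-≥ : ∀ G {k} (c : Fin (n G) → Fin k) v {x} (f : Fin x → Fin k) →
               (∀ i j → f i ≡ f j → i ≡ j) → (∀ i → ∃ λ u → T (adj G v u) × c u ≡ f i) →
               x ≤ nbrColours G c v
nbrColours-≥ G c v {x} f f-inj seen = begin
  x                                  ≡⟨ count-true x ⟨
  count {x} (λ _ → true)             ≤⟨ injectiveOn⇒count≤ f (λ i j _ _ → f-inj i j) f-seen ⟩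
  count (colourSeen G c v)           ≡⟨ nbrColours≡count G c v ⟨
  nbrColours G c v                   ∎
  where
  open ≤-Reasoning
  f-seen : ∀ i → T true → T (colourSeen G c v (f i))
  f-seen i _ = let u , v~u , cu≡fi = seen i in subst (T ∘ colourSeen G c v) cu≡fi (colourSeen⁺ G c v~u)

injectiveOnNbrs⇒deg≤nbrColours : ∀ G {k} (c : Fin (n G) → Fin k) v →
  (∀ u w → T (adj G v u) → T (adj G v w) → c u ≡ c w → u ≡ w) → deg G v ≤ nbrColours G c v
injectiveOnNbrs⇒deg≤nbrColours G c v c-inj = begin
  deg G v                   ≡⟨ deg≡count G v ⟩
  count (adj G v)           ≤⟨ injectiveOn⇒count≤ c c-inj (λ u → colourSeen⁺ G c) ⟩
  count (colourSeen G c v)  ≡⟨ nbrColours≡count G c v ⟨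
  nbrColours G c v          ∎
  where open ≤-Reasoning

hasNeighbour⇒1≤deg : ∀ G v → (∃ λ u → T (adj G v u)) → 1 ≤ deg G v
hasNeighbour⇒1≤deg G v (u , v~u) = begin
  1                            ≡⟨ count-singleton u ⟨
  count (λ w → isYes (u ≟ w))  ≤⟨ count-mono {p = λ w → isYes (u ≟ w)} {q = adj G v} u≡w⇒v~w ⟩
  count (adj G v)              ≡⟨ deg≡count G v ⟨
  deg G v                      ∎
  where
  open ≤-Reasoning
  u≡w⇒v~w : ∀ w → T (isYes (u ≟ w)) → T (adj G v w)
  u≡w⇒v~w w u≡w = subst (T ∘ adj G v) (toWitness u≡w) v~u

clique⇒≤colours : ∀ G {k} {c : Fin (n G) → Fin k} → IsProperColouring G c →
                  ∀ {x} (f : Fin x → Fin (n G)) → (∀ i j → i ≢ j → T (adj G (f i) (f j))) → x ≤ k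
clique⇒≤colours G {c = c} proper f clique = injective⇒≤ {f = c ∘ f} c∘f-inj
  where
  c∘f-inj : ∀ {i j} → c (f i) ≡ c (f j) → i ≡ j
  c∘f-inj {i} {j} same with i ≟ j
  ... | yes i≡j = i≡j
  ... | no  i≢j = ⊥-elim (proper (f i) (f j) (clique i j i≢j) same)

id-proper : ∀ G → Loopless G → IsProperColouring G id
id-proper G loopless u v u~v refl = loopless u u~v

identityColouring : ∀ r G → Loopless G → HasDynColouring r G (n G)
identityColouring r G loopless = id , id-proper G loopless , dynamic
  where
  dynamic : ∀ v → r ⊓ deg G v ≤ nbrColours G id v
  dynamic v = ≤-trans (m⊓n≤n r (deg G v)) (injectiveOnNbrs⇒deg≤nbrColours G id v (λ _ _ _ _ → id))

-- Without function extensionality, P has to be closed under pointwise equality.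
∃-function? : ∀ a {b} {P : (Fin a → Fin b) → Set} →
              (∀ {f g} → (∀ x → f x ≡ g x) → P f → P g) → (∀ f → Dec (P f)) →
              Dec (Σ (Fin a → Fin b) P)
∃-function? zero    resp P? = map′ (_ ,_) (λ (f , Pf) → resp (λ ()) Pf) (P? (λ ()))
∃-function? (suc a) resp P? =
  map′ (λ (b , f , Pb∷f) → b ∷ f , Pb∷f)
       (λ (f , Pf) → f zero , f ∘ suc , resp (λ { zero → refl ; (suc x) → refl }) Pf)
       (Fin.any? λ b → ∃-function? a (λ f≗g → resp λ { zero → refl ; (suc x) → f≗g x }) (P? ∘ (b ∷_)))

IsDynColouring-resp-≗ : ∀ r G {k} {c c′ : Fin (n G) → Fin k} → (∀ u → c u ≡ c′ u) →
                        IsDynColouring r G k c → IsDynColouring r G k c′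
IsDynColouring-resp-≗ r G {c = c} {c′} c≗c′ (proper , dynamic) = proper′ , dynamic′
  where
  proper′ : IsProperColouring G c′
  proper′ u v u~v same = proper u v u~v (trans (c≗c′ u) (trans same (sym (c≗c′ v))))
  dynamic′ : ∀ v → r ⊓ deg G v ≤ nbrColours G c′ v
  dynamic′ v = ≤-trans (dynamic v) (≤-trans
    (nbrColours-≤ G c v (colourSeen G c′ v) λ u v~u →
       subst (T ∘ colourSeen G c′ v) (sym (c≗c′ u)) (colourSeen⁺ G c′ v~u))
    (≤-reflexive (sym (nbrColours≡count G c′ v))))

isDynColouring? : ∀ r G k c → Dec (IsDynColouring r G k c)
isDynColouring? r G k c =
  Fin.all? (λ u → Fin.all? λ v → T? (adj G u v) →-dec ¬? (c u ≟ c v))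
  ×-dec Fin.all? (λ v → r ⊓ deg G v ≤? nbrColours G c v)

hasDynColouring? : ∀ r G k → Dec (HasDynColouring r G k)
hasDynColouring? r G k = ∃-function? (n G) (IsDynColouring-resp-≗ r G) (isDynColouring? r G k)

module _ {P : ℕ → Set} (P? : ∀ k → Dec (P k)) where

  least : ∀ v → (∃ λ k → k < v × P k) → ∃ λ k → P k × (∀ j → j < k → ¬ P j)
  least (suc v) (k , k<1+v , Pk) with anyUpTo? P? v
  ... | yes below = least v below
  ... | no ¬below = k , Pk , λ j j<k Pj → ¬below (j , <-≤-trans j<k (s≤s⁻¹ k<1+v) , Pj)

dynChromNum-exists : ∀ r G {k} → HasDynColouring r G k → ∃ λ χ → IsDynChromNum r G χ
dynChromNum-exists r G {k} colouring = least (hasDynColouring? r G) (suc k) (k , n<1+n k , colouring)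

isDynChromNum-intro : ∀ r G {k} → HasDynColouring r G k →
                      (∀ j c → IsDynColouring r G j c → k ≤ j) → IsDynChromNum r G k
isDynChromNum-intro r G colouring lower = colouring , λ j j<k (c , dyn) → <⇒≱ j<k (lower j c dyn)

dynChromNum-≥ : ∀ r G {k} → HasDynColouring r G k → ∀ a i₀ →
                (∀ j c → IsDynColouring r G j c → a + i₀ ≤ j) →
                ∃ λ i → i₀ ≤ i × IsDynChromNum r G (a + i)
dynChromNum-≥ r G colouring a i₀ lower with dynChromNum-exists r G colouring
... | χ , (c , dyn) , minimal = χ ∸ a , i₀≤χ∸a , subst (IsDynChromNum r G) (sym (m+[n∸m]≡n a≤χ)) ((c , dyn) , minimal)
  where
  a+i₀≤χ : a + i₀ ≤ χ
  a+i₀≤χ = lower χ c dyn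
  a≤χ : a ≤ χ
  a≤χ = ≤-trans (m≤m+n a i₀) a+i₀≤χ
  i₀≤χ∸a : i₀ ≤ χ ∸ a
  i₀≤χ∸a = ≤-trans (≤-reflexive (sym (m+n∸m≡n a i₀))) (∸-monoˡ-≤ a a+i₀≤χ)

-- Lexicographic products

adj-Lex : ∀ G₁ G₂ g h g′ h′ →
          adj (Lex G₁ G₂) (combine g h) (combine g′ h′) ≡ (adj G₁ g g′ ∨ (isYes (g ≟ g′) ∧ adj G₂ h h′))
adj-Lex G₁ G₂ g h g′ h′ = cong₂ adjPairs (remQuot-combine g h) (remQuot-combine g′ h′)
  where
  adjPairs : Fin (n G₁) × Fin (n G₂) → Fin (n G₁) × Fin (n G₂) → Bool
  adjPairs (g , h) (g′ , h′) = adj G₁ g g′ ∨ (isYes (g ≟ g′) ∧ adj G₂ h h′)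

data LexVertex {a b : ℕ} : Fin (a * b) → Set where
  ⟨_,_⟩ : (g : Fin a) (h : Fin b) → LexVertex (combine g h)

lexVertex : ∀ a b (u : Fin (a * b)) → LexVertex {a} {b} u
lexVertex a b u = subst LexVertex (combine-remQuot {a} b u) ⟨ proj₁ (remQuot {a} b u) , proj₂ (remQuot {a} b u) ⟩

Lex-loopless : ∀ G₁ G₂ → Loopless G₁ → Loopless G₂ → Loopless (Lex G₁ G₂)
Lex-loopless G₁ G₂ loopless₁ loopless₂ u with lexVertex (n G₁) (n G₂) u
... | ⟨ g , h ⟩ = λ u~u → case (Equivalence.to T-∨ (subst T (adj-Lex G₁ G₂ g h g h) u~u))
  where
  case : T (adj G₁ g g) ⊎ T (isYes (g ≟ g) ∧ adj G₂ h h) → ⊥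
  case (inj₁ g~g) = loopless₁ g g~g
  case (inj₂ h~h) = loopless₂ h (proj₂ (Equivalence.to T-∧ h~h))

deg-Lex : ∀ G₁ G₂ → Loopless G₁ → ∀ g h →
          deg (Lex G₁ G₂) (combine g h) ≡ deg G₁ g * n G₂ + deg G₂ h
deg-Lex G₁ G₂ loopless₁ g h = begin
  deg (Lex G₁ G₂) (combine g h)
    ≡⟨ deg≡count (Lex G₁ G₂) (combine g h) ⟩
  count (adj (Lex G₁ G₂) (combine g h))
    ≡⟨ count-combine (n G₁) (adj (Lex G₁ G₂) (combine g h)) ⟩
  sum inCopy
    ≡⟨ sum-cong-≗ inCopy≡ ⟩
  sum (λ g′ → across g′ * n G₂ + same g′ * d₂)
    ≡⟨ ∑-distrib-+ (λ g′ → across g′ * n G₂) (λ g′ → same g′ * d₂) ⟩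
  sum (λ g′ → across g′ * n G₂) + sum (λ g′ → same g′ * d₂)
    ≡⟨ cong₂ _+_ (*-distribʳ-sum (n G₂) across) (*-distribʳ-sum d₂ same) ⟨
  count (adj G₁ g) * n G₂ + count (λ g′ → isYes (g ≟ g′)) * d₂
    ≡⟨ cong (count (adj G₁ g) * n G₂ +_) (cong (_* d₂) (count-singleton g)) ⟩
  count (adj G₁ g) * n G₂ + 1 * d₂
    ≡⟨ cong₂ _+_ (cong (_* n G₂) (deg≡count G₁ g)) (sym (*-identityˡ d₂)) ⟨
  deg G₁ g * n G₂ + d₂
    ≡⟨ cong (deg G₁ g * n G₂ +_) (deg≡count G₂ h) ⟨
  deg G₁ g * n G₂ + deg G₂ h
    ∎
  where
  open ≡-Reasoning
  across same : Fin (n G₁) → ℕ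
  across g′ = indicator (adj G₁ g g′)
  same   g′ = indicator (isYes (g ≟ g′))
  d₂ : ℕ
  d₂ = count (adj G₂ h)
  inCopy : Fin (n G₁) → ℕ
  inCopy g′ = count (adj (Lex G₁ G₂) (combine g h) ∘ combine g′)
  inCopy≡ : ∀ g′ → inCopy g′ ≡ across g′ * n G₂ + same g′ * d₂
  inCopy≡ g′ = trans (count-cong (adj-Lex G₁ G₂ g h g′))
                   (count-∨-∧ (adj G₁ g g′) (isYes (g ≟ g′)) (adj G₂ h) λ g~g′ g≡g′ →
                      loopless₁ g (subst (T ∘ adj G₁ g) (sym (toWitness g≡g′)) g~g′))

Lex-adj-across : ∀ G₁ G₂ {g g′} h h′ → T (adj G₁ g g′) → T (adj (Lex G₁ G₂) (combine g h) (combine g′ h′))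
Lex-adj-across G₁ G₂ {g} {g′} h h′ g~g′ = subst T (sym (adj-Lex G₁ G₂ g h g′ h′)) (Equivalence.from T-∨ (inj₁ g~g′))

Lex-adj-within : ∀ G₁ G₂ g {h h′} → T (adj G₂ h h′) → T (adj (Lex G₁ G₂) (combine g h) (combine g h′))
Lex-adj-within G₁ G₂ g {h} {h′} h~h′ =
  subst T (sym (adj-Lex G₁ G₂ g h g h′))
    (Equivalence.from (T-∨ {adj G₁ g g}) (inj₂ (Equivalence.from T-∧ (fromWitness refl , h~h′))))

Lex-adj⁻ : ∀ G₁ G₂ {g h g′ h′} → T (adj (Lex G₁ G₂) (combine g h) (combine g′ h′)) →
           T (adj G₁ g g′) ⊎ (g ≡ g′ × T (adj G₂ h h′))
Lex-adj⁻ G₁ G₂ {g} {h} {g′} {h′} v~u with Equivalence.to T-∨ (subst T (adj-Lex G₁ G₂ g h g′ h′) v~u)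
... | inj₁ g~g′ = inj₁ g~g′
... | inj₂ within = let g≡g′ , h~h′ = Equivalence.to T-∧ within in inj₂ (toWitness g≡g′ , h~h′)

_⊗_ : ∀ {a b p q} → (Fin a → Fin p) → (Fin b → Fin q) → Fin (a * b) → Fin (p * q)
_⊗_ {b = b} φ ψ u = let g , h = remQuot b u in combine (φ g) (ψ h)

⊗-combine : ∀ {a b p q} (φ : Fin a → Fin p) (ψ : Fin b → Fin q) g h → (φ ⊗ ψ) (combine g h) ≡ combine (φ g) (ψ h)
⊗-combine {b = b} φ ψ g h = cong (λ (g , h) → combine (φ g) (ψ h)) (remQuot-combine g h)

⊗-proper : ∀ G₁ G₂ {p q} {φ : Fin (n G₁) → Fin p} {ψ : Fin (n G₂) → Fin q} →
           IsProperColouring G₁ φ → IsProperColouring G₂ ψ → IsProperColouring (Lex G₁ G₂) (φ ⊗ ψ)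
⊗-proper G₁ G₂ {φ = φ} {ψ} φ-proper ψ-proper u v
  with lexVertex (n G₁) (n G₂) u | lexVertex (n G₁) (n G₂) v
... | ⟨ g , h ⟩ | ⟨ g′ , h′ ⟩ = λ u~v same →
  let φg≡φg′ , ψh≡ψh′ = combine-injective (φ g) (ψ h) (φ g′) (ψ h′)
                          (trans (sym (⊗-combine φ ψ g h)) (trans same (⊗-combine φ ψ g′ h′)))
  in case (Lex-adj⁻ G₁ G₂ u~v) φg≡φg′ ψh≡ψh′
  where
  case : T (adj G₁ g g′) ⊎ (g ≡ g′ × T (adj G₂ h h′)) → φ g ≡ φ g′ → ψ h ≡ ψ h′ → ⊥
  case (inj₁ g~g′)       φ≡ _ = φ-proper g g′ g~g′ φ≡
  case (inj₂ (_ , h~h′)) _ ψ≡ = ψ-proper h h′ h~h′ ψ≡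

⊗-nbrColours : ∀ G₁ G₂ {p q} {φ : Fin (n G₁) → Fin p} {ψ : Fin (n G₂) → Fin q} →
               IsProperColouring G₁ φ → (∀ j → ∃ λ h → ψ h ≡ j) →
               ∀ g h → (∃ λ g′ → T (adj G₁ g g′)) → (∃ λ h′ → T (adj G₂ h h′)) →
               suc q ≤ nbrColours (Lex G₁ G₂) (φ ⊗ ψ) (combine g h)
⊗-nbrColours G₁ G₂ {q = q} {φ} {ψ} φ-proper ψ-onto g h (g′ , g~g′) (h′ , h~h′) =
  nbrColours-≥ (Lex G₁ G₂) (φ ⊗ ψ) (combine g h) colour colour-injective colour-seen
  where
  colour : Fin (suc q) → Fin _
  colour zero    = combine (φ g) (ψ h′)
  colour (suc j) = combine (φ g′) j
  colour-injective : ∀ i j → colour i ≡ colour j → i ≡ j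
  colour-injective zero    zero    _    = refl
  colour-injective zero    (suc j) same = ⊥-elim (φ-proper g g′ g~g′ (combine-injectiveˡ _ _ _ _ same))
  colour-injective (suc i) zero    same = ⊥-elim (φ-proper g g′ g~g′ (sym (combine-injectiveˡ _ _ _ _ same)))
  colour-injective (suc i) (suc j) same = cong suc (combine-injectiveʳ (φ g′) i (φ g′) j same)
  colour-seen : ∀ i → ∃ λ u → T (adj (Lex G₁ G₂) (combine g h) u) × (φ ⊗ ψ) u ≡ colour i
  colour-seen zero    = combine g h′ , Lex-adj-within G₁ G₂ g h~h′ , ⊗-combine φ ψ g h′
  colour-seen (suc j) = let h″ , ψh″≡j = ψ-onto j in
    combine g′ h″ , Lex-adj-across G₁ G₂ h h″ g~g′ , trans (⊗-combine φ ψ g′ h″) (cong (combine (φ g′)) ψh″≡j)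

⊗-injectiveOnNbrs : ∀ G₁ G₂ {p q} {φ : Fin (n G₁) → Fin p} {ψ : Fin (n G₂) → Fin q} →
  InjectiveOnClosedNbhds G₁ φ →
  (∀ h₁ h₂ → ψ h₁ ≡ ψ h₂ → h₁ ≡ h₂) →
  ∀ v u w → T (adj (Lex G₁ G₂) v u) → T (adj (Lex G₁ G₂) v w) → (φ ⊗ ψ) u ≡ (φ ⊗ ψ) w → u ≡ w
⊗-injectiveOnNbrs G₁ G₂ {φ = φ} {ψ} φ-inj ψ-inj v u w
  with lexVertex (n G₁) (n G₂) v | lexVertex (n G₁) (n G₂) u | lexVertex (n G₁) (n G₂) w
... | ⟨ g , h ⟩ | ⟨ g₁ , h₁ ⟩ | ⟨ g₂ , h₂ ⟩ = λ v~u v~w same →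
  let φ≡ , ψ≡ = combine-injective (φ g₁) (ψ h₁) (φ g₂) (ψ h₂)
                  (trans (sym (⊗-combine φ ψ g₁ h₁)) (trans same (⊗-combine φ ψ g₂ h₂)))
  in cong₂ combine (φ-inj g g₁ g₂ (closed (Lex-adj⁻ G₁ G₂ v~u)) (closed (Lex-adj⁻ G₁ G₂ v~w)) φ≡)
                   (ψ-inj h₁ h₂ ψ≡)
  where
  closed : ∀ {g′ h′} → T (adj G₁ g g′) ⊎ (g ≡ g′ × T (adj G₂ h h′)) → g ≡ g′ ⊎ T (adj G₁ g g′)
  closed (inj₁ g~g′)     = inj₂ g~g′
  closed (inj₂ (g≡g′ , _)) = inj₁ g≡g′

nbrColours-leaf≤ : ∀ G₁ G₂ {k} (c : Fin (n G₁ * n G₂) → Fin k) {g h h₀} (q : Fin k → Bool) →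
                   (∀ h′ → T (adj G₂ h h′) → h′ ≡ h₀) →
                   (∀ g′ h′ → T (adj G₁ g g′) → T (q (c (combine g′ h′)))) →
                   nbrColours (Lex G₁ G₂) c (combine g h) ≤ suc (count q)
nbrColours-leaf≤ G₁ G₂ {k} c {g} {h} {h₀} q leaf across = begin
  nbrColours (Lex G₁ G₂) c (combine g h)  ≤⟨ nbrColours-≤ (Lex G₁ G₂) c (combine g h) q′ seen⇒q′ ⟩
  count q′                                ≤⟨ count-∨ single q ⟩
  count single + count q                  ≡⟨ cong (_+ count q) (count-singleton (c (combine g h₀))) ⟩
  suc (count q)                           ∎
  where
  open ≤-Reasoning
  single : Fin k → Bool
  single j = isYes (c (combine g h₀) ≟ j)
  q′ : Fin k → Bool
  q′ j = single j ∨ q j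
  seen⇒q′ : ∀ u → T (adj (Lex G₁ G₂) (combine g h) u) → T (q′ (c u))
  seen⇒q′ u with lexVertex (n G₁) (n G₂) u
  ... | ⟨ g′ , h′ ⟩ = λ v~u → case (Lex-adj⁻ G₁ G₂ v~u)
    where
    case : T (adj G₁ g g′) ⊎ (g ≡ g′ × T (adj G₂ h h′)) → T (q′ (c (combine g′ h′)))
    case (inj₁ g~g′)          = Equivalence.from (T-∨ {single (c (combine g′ h′))}) (inj₂ (across g′ h′ g~g′))
    case (inj₂ (refl , h~h′)) = Equivalence.from (T-∨ {single (c (combine g′ h′))})
                                  (inj₁ (fromWitness (cong (c ∘ combine g) (sym (leaf h′ h~h′)))))

leafPair-lowerBound : ∀ G₁ G₂ {k} {c : Fin (n G₁ * n G₂) → Fin k} → IsProperColouring (Lex G₁ G₂) c →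
  ∀ {g₀ g h h₀} → (∀ g′ → T (adj G₁ g₀ g′) → g′ ≡ g) → (∀ h′ → T (adj G₂ h h′) → h′ ≡ h₀) →
  (nbrColours (Lex G₁ G₂) c (combine g₀ h) ∸ 1) + (nbrColours (Lex G₁ G₂) c (combine g h) ∸ 1) ≤ k
leafPair-lowerBound G₁ G₂ {k} {c} proper {g₀} {g} {h} {h₀} g₀-end h-leaf = begin
  (nbrColours (Lex G₁ G₂) c (combine g₀ h) ∸ 1) + (nbrColours (Lex G₁ G₂) c (combine g h) ∸ 1)
    ≤⟨ +-mono-≤ (∸-monoˡ-≤ 1 (nbrColours-leaf≤ G₁ G₂ c onCopy h-leaf onCopy-seen))
                (∸-monoˡ-≤ 1 (nbrColours-leaf≤ G₁ G₂ c nearCopy h-leaf nearCopy-seen)) ⟩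
  count onCopy + count nearCopy
    ≡⟨ count-∨-disjoint {p = onCopy} {q = nearCopy} disjoint ⟨
  count (λ j → onCopy j ∨ nearCopy j)
    ≤⟨ count-≤ (λ j → onCopy j ∨ nearCopy j) ⟩
  k ∎
  where
  open ≤-Reasoning
  onCopy : Fin k → Bool
  onCopy j = isYes (Fin.any? λ h′ → c (combine g h′) ≟ j)
  nearCopy : Fin k → Bool
  nearCopy j = isYes (Fin.any? λ g′ → T? (adj G₁ g g′) ×-dec Fin.any? λ h′ → c (combine g′ h′) ≟ j)
  onCopy-seen : ∀ g′ h′ → T (adj G₁ g₀ g′) → T (onCopy (c (combine g′ h′)))
  onCopy-seen g′ h′ g₀~g′ rewrite g₀-end g′ g₀~g′ = fromWitness (h′ , refl)
  nearCopy-seen : ∀ g′ h′ → T (adj G₁ g g′) → T (nearCopy (c (combine g′ h′)))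
  nearCopy-seen g′ h′ g~g′ = fromWitness (g′ , g~g′ , h′ , refl)
  disjoint : ∀ j → T (onCopy j) → T (nearCopy j) → ⊥
  disjoint j on near with toWitness on | toWitness near
  ... | h₁ , c₁≡j | g′ , g~g′ , h₂ , c₂≡j =
    proper (combine g h₁) (combine g′ h₂) (Lex-adj-across G₁ G₂ h₁ h₂ g~g′) (trans c₁≡j (sym c₂≡j))

Lex-clique : ∀ G₁ G₂ {a b} (e₁ : Fin a → Fin (n G₁)) (e₂ : Fin b → Fin (n G₂)) →
             (∀ i j → i ≢ j → T (adj G₁ (e₁ i) (e₁ j))) → (∀ i j → i ≢ j → T (adj G₂ (e₂ i) (e₂ j))) →
             ∀ i j → i ≢ j → T (adj (Lex G₁ G₂) ((e₁ ⊗ e₂) i) ((e₁ ⊗ e₂) j))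
Lex-clique G₁ G₂ {a} {b} e₁ e₂ clique₁ clique₂ i j with lexVertex a b i | lexVertex a b j
... | ⟨ g , h ⟩ | ⟨ g′ , h′ ⟩ = λ i≢j →
  subst T (sym (cong₂ (adj (Lex G₁ G₂)) (⊗-combine e₁ e₂ g h) (⊗-combine e₁ e₂ g′ h′))) (adjacent i≢j)
  where
  adjacent : combine g h ≢ combine g′ h′ → T (adj (Lex G₁ G₂) (combine (e₁ g) (e₂ h)) (combine (e₁ g′) (e₂ h′)))
  adjacent i≢j with g ≟ g′
  ... | no  g≢g′ = Lex-adj-across G₁ G₂ (e₂ h) (e₂ h′) (clique₁ g g′ g≢g′)
  ... | yes refl = Lex-adj-within G₁ G₂ (e₁ g) (clique₂ h h′ (i≢j ∘ cong (combine g)))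

-- Paths and stars

Consecutive : ℕ → ℕ → Set
Consecutive a b = suc a ≡ b ⊎ suc b ≡ a

pathAdj⁻ : ∀ {l} {i j : Fin l} → T (pathAdj l i j) → Consecutive (toℕ i) (toℕ j)
pathAdj⁻ {i = i} {j} i~j with Equivalence.to (T-∨ {suc (toℕ i) ≡ᵇ toℕ j}) i~j
... | inj₁ i+1≡j = inj₁ (≡ᵇ⇒≡ _ _ i+1≡j)
... | inj₂ j+1≡i = inj₂ (≡ᵇ⇒≡ _ _ j+1≡i)

pathAdj⁺ : ∀ {l} {i j : Fin l} → Consecutive (toℕ i) (toℕ j) → T (pathAdj l i j)
pathAdj⁺ {i = i} {j} (inj₁ i+1≡j) = Equivalence.from (T-∨ {suc (toℕ i) ≡ᵇ toℕ j}) (inj₁ (≡⇒≡ᵇ _ _ i+1≡j))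
pathAdj⁺ {i = i} {j} (inj₂ j+1≡i) = Equivalence.from (T-∨ {suc (toℕ i) ≡ᵇ toℕ j}) (inj₂ (≡⇒≡ᵇ _ _ j+1≡i))

Path-loopless : ∀ l → Loopless (Path l)
Path-loopless l g g~g with pathAdj⁻ {l} {g} g~g
... | inj₁ g+1≡g = 1+n≢n g+1≡g
... | inj₂ g+1≡g = 1+n≢n g+1≡g

pathNeighbour : ∀ {l} (g : Fin (2 + l)) → ∃ λ g′ → T (adj (Path (2 + l)) g g′)
pathNeighbour zero    = 1F , _
pathNeighbour (suc g) = inject₁ g , pathAdj⁺ (inj₂ (cong suc (toℕ-inject₁ g)))

Path-end : ∀ {l} (g : Fin (2 + l)) → T (adj (Path (2 + l)) 0F g) → g ≡ 1F
Path-end 1F _ = refl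

deg-Path-end : ∀ l → deg (Path (2 + l)) 0F ≡ 1
deg-Path-end l = trans (deg≡count (Path (2 + l)) 0F) (cong suc (count-false l))

deg-Path-second : ∀ l → deg (Path (3 + l)) 1F ≡ 2
deg-Path-second l = trans (deg≡count (Path (3 + l)) 1F) (cong (2 +_) (count-false l))

Star-loopless : ∀ m → Loopless (Star m)
Star-loopless m h with isCentre h
... | true  = id
... | false = id

starAdj-centre : ∀ {m} {h h′ : Fin m} → T (adj (Star m) h h′) → isCentre h ≡ not (isCentre h′)
starAdj-centre {h = h} {h′} with isCentre h | isCentre h′
... | true  | false = λ _ → refl
... | false | true  = λ _ → refl
... | true  | true  = λ ()
... | false | false = λ ()

Star-leaf : ∀ {m} (i : Fin m) h → T (adj (Star (suc m)) (suc i) h) → h ≡ 0F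
Star-leaf i 0F _ = refl

starNeighbour : ∀ {m} (h : Fin (2 + m)) → ∃ λ h′ → T (adj (Star (2 + m)) h h′)
starNeighbour zero    = 1F , _
starNeighbour (suc _) = 0F , _

deg-Star-centre : ∀ m → deg (Star (suc m)) 0F ≡ m
deg-Star-centre m = trans (deg≡count (Star (suc m)) 0F) (count-true m)

deg-Star-leaf : ∀ {m} (i : Fin m) → deg (Star (suc m)) (suc i) ≡ 1
deg-Star-leaf {m} i = trans (deg≡count (Star (suc m)) (suc i)) (cong suc (count-false m))

parity : ℕ → Fin 2
parity 0             = 0F
parity 1             = 1F
parity (suc (suc n)) = parity n

parity-suc : ∀ n → parity (suc n) ≢ parity n
parity-suc 0             ()
parity-suc 1             ()
parity-suc (suc (suc n)) = parity-suc n

mod3 : ℕ → Fin 3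
mod3 0                   = 0F
mod3 1                   = 1F
mod3 2                   = 2F
mod3 (suc (suc (suc n))) = mod3 n

mod3-suc : ∀ n → mod3 (suc n) ≢ mod3 n
mod3-suc 0                   ()
mod3-suc 1                   ()
mod3-suc 2                   ()
mod3-suc (suc (suc (suc n))) = mod3-suc n

mod3-suc-suc : ∀ n → mod3 (2 + n) ≢ mod3 n
mod3-suc-suc 0                   ()
mod3-suc-suc 1                   ()
mod3-suc-suc 2                   ()
mod3-suc-suc (suc (suc (suc n))) = mod3-suc-suc n

parity-proper : ∀ l → IsProperColouring (Path l) (parity ∘ toℕ)
parity-proper l i j i~j with pathAdj⁻ {l} {i} {j} i~j
... | inj₁ i+1≡j = λ same → parity-suc (toℕ i) (trans (cong parity i+1≡j) (sym same))
... | inj₂ j+1≡i = λ same → parity-suc (toℕ j) (trans (cong parity j+1≡i) same)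

mod3-injective-near : ∀ {t a b} → t ≡ a ⊎ Consecutive t a → t ≡ b ⊎ Consecutive t b → mod3 a ≡ mod3 b → a ≡ b
mod3-injective-near             (inj₁ refl)        (inj₁ refl)        _    = refl
mod3-injective-near {t}         (inj₁ refl)        (inj₂ (inj₁ refl)) same = ⊥-elim (mod3-suc t (sym same))
mod3-injective-near {b = b}     (inj₁ refl)        (inj₂ (inj₂ refl)) same = ⊥-elim (mod3-suc b same)
mod3-injective-near {t}         (inj₂ (inj₁ refl)) (inj₁ refl)        same = ⊥-elim (mod3-suc t same)
mod3-injective-near             (inj₂ (inj₁ refl)) (inj₂ (inj₁ refl)) _    = refl
mod3-injective-near {b = b}     (inj₂ (inj₁ refl)) (inj₂ (inj₂ refl)) same = ⊥-elim (mod3-suc-suc b same)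
mod3-injective-near {a = a}     (inj₂ (inj₂ refl)) (inj₁ refl)        same = ⊥-elim (mod3-suc a (sym same))
mod3-injective-near {a = a}     (inj₂ (inj₂ refl)) (inj₂ (inj₁ refl)) same = ⊥-elim (mod3-suc-suc a (sym same))
mod3-injective-near (inj₂ (inj₂ a+1≡t)) (inj₂ (inj₂ b+1≡t)) _ = suc-injective (trans a+1≡t (sym b+1≡t))

mod3-injectiveOnClosedNbhds : ∀ l → InjectiveOnClosedNbhds (Path l) (mod3 ∘ toℕ)
mod3-injectiveOnClosedNbhds l g g₁ g₂ near₁ near₂ same =
  toℕ-injective (mod3-injective-near (closed near₁) (closed near₂) same)
  where
  closed : ∀ {g′} → g ≡ g′ ⊎ T (pathAdj l g g′) → toℕ g ≡ toℕ g′ ⊎ Consecutive (toℕ g) (toℕ g′)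
  closed (inj₁ g≡g′) = inj₁ (cong toℕ g≡g′)
  closed (inj₂ g~g′) = inj₂ (pathAdj⁻ g~g′)

centreColour : ∀ {m} → Fin m → Fin 2
centreColour h = if isCentre h then 0F else 1F

centreColour-proper : ∀ m → IsProperColouring (Star m) centreColour
centreColour-proper m h h′ h~h′ with isCentre h | isCentre h′ | starAdj-centre {m} {h} {h′} h~h′
... | true  | false | _ = λ ()
... | false | true  | _ = λ ()

centreColour-onto : ∀ {m} (j : Fin 2) → ∃ λ (h : Fin (2 + m)) → centreColour h ≡ j
centreColour-onto 0F = 0F , refl
centreColour-onto 1F = 1F , refl

-- The graph P_l[K_{1,m}]

PathStar : ℕ → ℕ → Graph
PathStar l m = Lex (Path l) (Star m)

PathStar-loopless : ∀ l m → Loopless (PathStar l m)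
PathStar-loopless l m = Lex-loopless (Path l) (Star m) (Path-loopless l) (Star-loopless m)

deg-PathStar : ∀ l m g h → deg (PathStar l m) (combine g h) ≡ deg (Path l) g * m + deg (Star m) h
deg-PathStar l m = deg-Lex (Path l) (Star m) (Path-loopless l)

endLeaf secondLeaf secondCentre : ∀ {l m} → Fin ((2 + l) * (2 + m))
endLeaf      {l} {m} = combine {2 + l} {2 + m} 0F 1F
secondLeaf   {l} {m} = combine {2 + l} {2 + m} 1F 1F
secondCentre {l} {m} = combine {2 + l} {2 + m} 1F 0F

module _ {l m : ℕ} where

  deg-PathStar-≥ : ∀ v → suc (2 + m) ≤ deg (PathStar (2 + l) (2 + m)) v
  deg-PathStar-≥ v with lexVertex (2 + l) (2 + m) v
  ... | ⟨ g , h ⟩ = begin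
    suc (2 + m)                                          ≡⟨ cong suc (*-identityˡ (2 + m)) ⟨
    suc (1 * (2 + m))                                    ≡⟨ +-comm 1 _ ⟩
    1 * (2 + m) + 1                                      ≤⟨ +-mono-≤ (*-monoˡ-≤ (2 + m) (hasNeighbour⇒1≤deg (Path (2 + l)) g (pathNeighbour g)))
                                                                     (hasNeighbour⇒1≤deg (Star (2 + m)) h (starNeighbour h)) ⟩
    deg (Path (2 + l)) g * (2 + m) + deg (Star (2 + m)) h ≡⟨ deg-PathStar (2 + l) (2 + m) g h ⟨
    deg (PathStar (2 + l) (2 + m)) (combine g h)         ∎
    where open ≤-Reasoning

  deg-PathStar-endLeaf : deg (PathStar (2 + l) (2 + m)) (endLeaf {l} {m}) ≡ suc (2 + m)
  deg-PathStar-endLeaf = begin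
    deg (PathStar (2 + l) (2 + m)) (endLeaf {l} {m})           ≡⟨ deg-PathStar (2 + l) (2 + m) 0F 1F ⟩
    deg (Path (2 + l)) 0F * (2 + m) + deg (Star (2 + m)) 1F
      ≡⟨ cong₂ (λ d e → d * (2 + m) + e) (deg-Path-end l) (deg-Star-leaf {suc m} 0F) ⟩
    1 * (2 + m) + 1                                          ≡⟨ cong (_+ 1) (*-identityˡ (2 + m)) ⟩
    (2 + m) + 1                                              ≡⟨ +-comm (2 + m) 1 ⟩
    suc (2 + m)                                              ∎
    where open ≡-Reasoning

  deg-PathStar-secondLeaf : deg (PathStar (3 + l) (2 + m)) (secondLeaf {suc l} {m}) ≡ 2 * (2 + m) + 1
  deg-PathStar-secondLeaf = trans (deg-PathStar (3 + l) (2 + m) 1F 1F)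
    (cong₂ (λ d e → d * (2 + m) + e) (deg-Path-second l) (deg-Star-leaf {suc m} 0F))

  deg-PathStar-secondCentre : deg (PathStar (3 + l) (2 + m)) (secondCentre {suc l} {m}) ≡ 2 * (2 + m) + suc m
  deg-PathStar-secondCentre = trans (deg-PathStar (3 + l) (2 + m) 1F 0F)
    (cong₂ (λ d e → d * (2 + m) + e) (deg-Path-second l) (deg-Star-centre (suc m)))

  minDeg-PathStar : ∀ {δ} → IsMinDeg (PathStar (2 + l) (2 + m)) δ → δ ≡ suc (2 + m)
  minDeg-PathStar (δ≤deg , v , deg≡δ) = ≤-antisym
    (≤-trans (δ≤deg (endLeaf {l} {m})) (≤-reflexive deg-PathStar-endLeaf))
    (subst (suc (2 + m) ≤_) deg≡δ (deg-PathStar-≥ v))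

  maxDeg-PathStar : ∀ {Δ} → IsMaxDeg (PathStar (3 + l) (2 + m)) Δ → 2 * (2 + m) + suc m ≤ Δ
  maxDeg-PathStar (deg≤Δ , _) = ≤-trans (≤-reflexive (sym deg-PathStar-secondCentre)) (deg≤Δ (secondCentre {suc l} {m}))

  dyn-lowerBound : ∀ {r k c} → IsDynColouring r (PathStar (2 + l) (2 + m)) k c → ∀ {a b} →
                   a ≤ r → a ≤ suc (2 + m) → b ≤ r → b ≤ deg (PathStar (2 + l) (2 + m)) (secondLeaf {l} {m}) →
                   (a ∸ 1) + (b ∸ 1) ≤ k
  dyn-lowerBound (proper , dynamic) a≤r a≤d b≤r b≤d = ≤-trans
    (+-mono-≤ (∸-monoˡ-≤ 1 (≤-trans (⊓-glb a≤r (≤-trans a≤d (≤-reflexive (sym deg-PathStar-endLeaf))))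
                                    (dynamic (endLeaf {l} {m}))))
              (∸-monoˡ-≤ 1 (≤-trans (⊓-glb b≤r b≤d) (dynamic (secondLeaf {l} {m})))))
    (leafPair-lowerBound (Path (2 + l)) (Star (2 + m)) proper {0F} {1F} {1F} {0F} Path-end (Star-leaf 0F))

  dyn-lowerBound-≥δ : ∀ {r k c} → IsDynColouring r (PathStar (2 + l) (2 + m)) k c → suc (2 + m) ≤ r → 2 * (2 + m) ≤ k
  dyn-lowerBound-≥δ colouring δ≤r = ≤-trans (≤-reflexive (cong ((2 + m) +_) (+-identityʳ (2 + m))))
    (dyn-lowerBound colouring δ≤r ≤-refl δ≤r (deg-PathStar-≥ (secondLeaf {l} {m})))

  proper⇒4≤ : ∀ {k} {c : Fin ((2 + l) * (2 + m)) → Fin k} → IsProperColouring (PathStar (2 + l) (2 + m)) c → 4 ≤ k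
  proper⇒4≤ proper = clique⇒≤colours (PathStar (2 + l) (2 + m)) proper (e₁ ⊗ e₂)
    (Lex-clique (Path (2 + l)) (Star (2 + m)) e₁ e₂ clique₁ clique₂)
    where
    e₁ : Fin 2 → Fin (2 + l)
    e₁ = _↑ˡ l
    e₂ : Fin 2 → Fin (2 + m)
    e₂ = _↑ˡ m
    clique₁ : ∀ i j → i ≢ j → T (adj (Path (2 + l)) (e₁ i) (e₁ j))
    clique₁ 0F 0F 0≢0 = ⊥-elim (0≢0 refl)
    clique₁ 0F 1F _   = _
    clique₁ 1F 0F _   = _
    clique₁ 1F 1F 1≢1 = ⊥-elim (1≢1 refl)
    clique₂ : ∀ i j → i ≢ j → T (adj (Star (2 + m)) (e₂ i) (e₂ j))
    clique₂ 0F 0F 0≢0 = ⊥-elim (0≢0 refl)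
    clique₂ 0F 1F _   = _
    clique₂ 1F 0F _   = _
    clique₂ 1F 1F 1≢1 = ⊥-elim (1≢1 refl)

  ⊗-nbrColours-PathStar : ∀ {p q} {φ : Fin (2 + l) → Fin p} {ψ : Fin (2 + m) → Fin q} →
    IsProperColouring (Path (2 + l)) φ → (∀ j → ∃ λ h → ψ h ≡ j) →
    ∀ v → suc q ≤ nbrColours (PathStar (2 + l) (2 + m)) (φ ⊗ ψ) v
  ⊗-nbrColours-PathStar φ-proper ψ-onto v with lexVertex (2 + l) (2 + m) v
  ... | ⟨ g , h ⟩ = ⊗-nbrColours (Path (2 + l)) (Star (2 + m)) φ-proper ψ-onto g h (pathNeighbour g) (starNeighbour h)

  dynChromNum-PathStar-≤3 : ∀ {r} → r ≤ 3 → IsDynChromNum r (PathStar (2 + l) (2 + m)) 4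
  dynChromNum-PathStar-≤3 {r} r≤3 =
    isDynChromNum-intro r (PathStar (2 + l) (2 + m)) (c , c-proper , c-dynamic) (λ _ _ (proper , _) → proper⇒4≤ proper)
    where
    c : Fin ((2 + l) * (2 + m)) → Fin (2 * 2)
    c = (parity ∘ toℕ {2 + l}) ⊗ centreColour {2 + m}
    c-proper : IsProperColouring (PathStar (2 + l) (2 + m)) c
    c-proper = ⊗-proper (Path (2 + l)) (Star (2 + m)) (parity-proper (2 + l)) (centreColour-proper (2 + m))
    c-dynamic : ∀ v → r ⊓ deg (PathStar (2 + l) (2 + m)) v ≤ nbrColours (PathStar (2 + l) (2 + m)) c v
    c-dynamic v = ≤-trans (m⊓n≤m r _) (≤-trans r≤3 (⊗-nbrColours-PathStar (parity-proper (2 + l)) centreColour-onto v))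

  dynChromNum-PathStar-δ : ∀ {δ} → IsMinDeg (PathStar (2 + l) (2 + m)) δ →
                           IsDynChromNum δ (PathStar (2 + l) (2 + m)) (2 * (2 + m))
  dynChromNum-PathStar-δ {δ} minDeg rewrite minDeg-PathStar minDeg =
    isDynChromNum-intro δ′ (PathStar (2 + l) (2 + m)) (c , c-proper , c-dynamic)
      (λ _ _ colouring → dyn-lowerBound-≥δ colouring ≤-refl)
    where
    δ′ : ℕ
    δ′ = suc (2 + m)
    c : Fin ((2 + l) * (2 + m)) → Fin (2 * (2 + m))
    c = (parity ∘ toℕ {2 + l}) ⊗ id {A = Fin (2 + m)}
    c-proper : IsProperColouring (PathStar (2 + l) (2 + m)) c
    c-proper = ⊗-proper (Path (2 + l)) (Star (2 + m)) (parity-proper (2 + l)) (id-proper (Star (2 + m)) (Star-loopless (2 + m)))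
    c-dynamic : ∀ v → δ′ ⊓ deg (PathStar (2 + l) (2 + m)) v ≤ nbrColours (PathStar (2 + l) (2 + m)) c v
    c-dynamic v = ≤-trans (m⊓n≤m δ′ _) (⊗-nbrColours-PathStar (parity-proper (2 + l)) (λ j → j , refl) v)

  dynChromNum-PathStar-<δ : ∀ {δ} → IsMinDeg (PathStar (2 + l) (2 + m)) δ → ∀ r → 4 ≤ r → r ≤ δ ∸ 1 →
                            ∃ λ i → 2 ≤ i × IsDynChromNum r (PathStar (2 + l) (2 + m)) (r + i)
  dynChromNum-PathStar-<δ minDeg r 4≤r r<δ rewrite minDeg-PathStar minDeg =
    dynChromNum-≥ r (PathStar (2 + l) (2 + m)) (identityColouring r _ (PathStar-loopless (2 + l) (2 + m))) r 2
      λ _ _ colouring → ≤-trans (+2≤pred+pred 4≤r)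
        (dyn-lowerBound colouring ≤-refl (m≤n⇒m≤1+n r<δ) ≤-refl
                        (≤-trans (m≤n⇒m≤1+n r<δ) (deg-PathStar-≥ (secondLeaf {l} {m}))))
    where
    +2≤pred+pred : ∀ {r} → 4 ≤ r → r + 2 ≤ (r ∸ 1) + (r ∸ 1)
    +2≤pred+pred {suc r} (s≤s 3≤r) = ≤-trans (≤-reflexive (sym (+-suc r 2))) (+-monoʳ-≤ r 3≤r)

dynChromNum-PathStar-l≡2 : ∀ {l m δ} → IsMinDeg (PathStar (2 + l) (2 + m)) δ → 2 + l ≡ 2 →
                           ∀ r → δ ≤ r → IsDynChromNum r (PathStar (2 + l) (2 + m)) (2 * (2 + m))
dynChromNum-PathStar-l≡2 {zero} {m} minDeg refl r δ≤r rewrite minDeg-PathStar {0} {m} minDeg =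
  isDynChromNum-intro r (PathStar 2 (2 + m)) (identityColouring r _ (PathStar-loopless 2 (2 + m)))
    λ _ _ colouring → dyn-lowerBound-≥δ colouring δ≤r

dynChromNum-PathStar->δ : ∀ {l m δ} → IsMinDeg (PathStar (2 + l) (2 + m)) δ → 2 + l ≢ 2 →
                          ∀ r → δ + 1 ≤ r → ∃ λ i → 1 ≤ i × IsDynChromNum r (PathStar (2 + l) (2 + m)) (2 * (2 + m) + i)
dynChromNum-PathStar->δ {zero}      _      l≢2 = ⊥-elim (l≢2 refl)
dynChromNum-PathStar->δ {suc l} {m} minDeg _ r δ+1≤r rewrite minDeg-PathStar {suc l} {m} minDeg =
  dynChromNum-≥ r (PathStar (3 + l) (2 + m)) (identityColouring r _ (PathStar-loopless (3 + l) (2 + m))) (2 * (2 + m)) 1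
    λ _ _ colouring → ≤-trans (≤-reflexive (2M+1≡M+[M+1] m))
      (dyn-lowerBound colouring (≤-trans (n≤1+n _) δ+1≤r′) ≤-refl δ+1≤r′ δ+1≤deg)
  where
  δ+1≤r′ : suc (suc (2 + m)) ≤ r
  δ+1≤r′ = ≤-trans (≤-reflexive (+-comm 1 (suc (2 + m)))) δ+1≤r
  2M+1≡M+[M+1] : ∀ m → 2 * (2 + m) + 1 ≡ (2 + m) + suc (2 + m)
  2M+1≡M+[M+1] = solve-∀
  2M+1≡[M+2]+[m+1] : ∀ m → 2 * (2 + m) + 1 ≡ suc (suc (2 + m)) + suc m
  2M+1≡[M+2]+[m+1] = solve-∀
  δ+1≤deg : suc (suc (2 + m)) ≤ deg (PathStar (3 + l) (2 + m)) (secondLeaf {suc l} {m})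
  δ+1≤deg = ≤-trans (m≤m+n _ (suc m)) (≤-reflexive (sym (trans (deg-PathStar-secondLeaf {l} {m}) (2M+1≡[M+2]+[m+1] m))))

dynChromNum-PathStar-≥Δ : ∀ {l m Δ} → IsMaxDeg (PathStar (2 + l) (2 + m)) Δ → 3 ≤ 2 + l →
                          ∀ r → Δ ∸ (2 + m) + 2 ≤ r → IsDynChromNum r (PathStar (2 + l) (2 + m)) (3 * (2 + m))
dynChromNum-PathStar-≥Δ {zero} _ (s≤s (s≤s ()))
dynChromNum-PathStar-≥Δ {suc l} {m} {Δ} maxDeg _ r Δ∸M+2≤r =
  isDynChromNum-intro r G (c , c-proper , c-dynamic)
    λ _ _ colouring → dyn-lowerBound colouring (≤-trans (s≤s (m≤m+n (2 + m) _)) 2M+1≤r) ≤-refl 2M+1≤r 2M+1≤deg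
  where
  G : Graph
  G = PathStar (3 + l) (2 + m)
  c : Fin ((3 + l) * (2 + m)) → Fin (3 * (2 + m))
  c = (mod3 ∘ toℕ {3 + l}) ⊗ id {A = Fin (2 + m)}
  c-proper : IsProperColouring G c
  c-proper = ⊗-proper (Path (3 + l)) (Star (2 + m)) (injectiveOnClosedNbhds⇒proper (Path (3 + l)) (Path-loopless (3 + l)) (mod3-injectiveOnClosedNbhds (3 + l))) (id-proper (Star (2 + m)) (Star-loopless (2 + m)))
  c-dynamic : ∀ v → r ⊓ deg G v ≤ nbrColours G c v
  c-dynamic v = ≤-trans (m⊓n≤n r _) (injectiveOnNbrs⇒deg≤nbrColours G c v
    (⊗-injectiveOnNbrs (Path (3 + l)) (Star (2 + m)) (mod3-injectiveOnClosedNbhds (3 + l)) (λ _ _ → id) v))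
  2M+1≤deg : suc (2 * (2 + m)) ≤ deg G (secondLeaf {suc l} {m})
  2M+1≤deg = ≤-reflexive (sym (trans (deg-PathStar-secondLeaf {l} {m}) (+-comm (2 * (2 + m)) 1)))
  2M+1≤r : suc (2 * (2 + m)) ≤ r
  2M+1≤r = begin
    suc (2 * (2 + m))                            ≡⟨ M+m+1+2≡2M+1 m ⟨
    (2 + m + suc m) + 2                          ≡⟨ cong (_+ 2) (m+n∸m≡n (2 + m) (2 + m + suc m)) ⟨
    (2 + m) + (2 + m + suc m) ∸ (2 + m) + 2      ≡⟨ cong (λ x → x ∸ (2 + m) + 2) (M+[M+m+1]≡2M+m+1 m) ⟩
    2 * (2 + m) + suc m ∸ (2 + m) + 2            ≤⟨ +-monoˡ-≤ 2 (∸-monoˡ-≤ (2 + m) (maxDeg-PathStar {l} {m} maxDeg)) ⟩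
    Δ ∸ (2 + m) + 2                              ≤⟨ Δ∸M+2≤r ⟩
    r                                            ∎
    where
    open ≤-Reasoning
    M+[M+m+1]≡2M+m+1 : ∀ m → (2 + m) + (2 + m + suc m) ≡ 2 * (2 + m) + suc m
    M+[M+m+1]≡2M+m+1 = solve-∀
    M+m+1+2≡2M+1 : ∀ m → (2 + m + suc m) + 2 ≡ suc (2 * (2 + m))
    M+m+1+2≡2M+1 = solve-∀

theorem2 : (l m δ Δ : ℕ) → 2 ≤ l → 3 ≤ m →
    IsMinDeg (Lex (Path l) (Star m)) δ → IsMaxDeg (Lex (Path l) (Star m)) Δ →
    ((∀ r → 1 ≤ r → r ≤ 3 → IsDynChromNum r (Lex (Path l) (Star m)) 4))
    × (∀ r → 4 ≤ r → r ≤ δ ∸ 1 →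
         ∃ λ i → 2 ≤ i × IsDynChromNum r (Lex (Path l) (Star m)) (r + i))
    × (l ≡ 2 → ∀ r → δ ≤ r → r ≤ Δ → IsDynChromNum r (Lex (Path l) (Star m)) (2 * m))
    × (l ≢ 2 → IsDynChromNum δ (Lex (Path l) (Star m)) (2 * m))
    × (l ≢ 2 → ∀ r → δ + 1 ≤ r → r ≤ Δ ∸ m + 1 →
         ∃ λ i → 1 ≤ i × IsDynChromNum r (Lex (Path l) (Star m)) (2 * m + i))
    × (3 ≤ l → ∀ r → Δ ∸ m + 2 ≤ r → r ≤ Δ → IsDynChromNum r (Lex (Path l) (Star m)) (3 * m))
theorem2 (suc (suc l)) (suc (suc (suc m))) δ Δ (s≤s (s≤s z≤n)) (s≤s (s≤s (s≤s z≤n))) minDeg maxDeg =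
    (λ _ _ → dynChromNum-PathStar-≤3)
  , dynChromNum-PathStar-<δ minDeg
  , (λ l≡2 r δ≤r _ → dynChromNum-PathStar-l≡2 minDeg l≡2 r δ≤r)
  , (λ _ → dynChromNum-PathStar-δ minDeg)
  , (λ l≢2 r δ<r _ → dynChromNum-PathStar->δ minDeg l≢2 r δ<r)
  , (λ 3≤l r Δ∸m+2≤r _ → dynChromNum-PathStar-≥Δ maxDeg 3≤l r Δ∸m+2≤r)
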